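{- Consider the graphical process on $G$ run with the allocation strategy described in the context. At every time $t$, writing $L=L^t$, for every vertex $y$ of $G$ the strategy places the ball at time $t+1$ on $y$ (conditionally on the history up to time $t$) with probability \[q(y)=\frac1n+\frac{1}{2m}\sum_{i\in I_T}d_i(y)\,Q_L(i).\] Equivalently, $2m\,(q(y)-1/n)=\sum_{i\in I_T}d_i(y)Q_L(i)$.
   Context: $G=(V,E)$ is a $d$-regular graph on $n$ vertices, $m=|E|=dn/2$, with edge-connectivity $k\ge1$. Graphical process: at each time $t=1,2,\dots$ an edge of $E$ is chosen uniformly at random independently of the past, and the ball is placed on one of its endpoints; $L^t(v)$ is the load of $v$ after $t$ steps ($L^0\equiv0$); for $S\subseteq V$, $\overline L^t(S)=\frac1{|S|}\sum_{v\in S}L^t(v)$. Hierarchical decomposition: rooted tree whose nodes $i$ correspond to subsets $S_i\subseteq V$, root $V$, children's sets partitioning the parent's set, leaves the singletons. Räcke decomposition with congestion ratio $\alpha_G\ge1$: a well-balanced ($|S_j|\le\frac34|S_i|$ for children $j$ of $i$) hierarchical decomposition $R$ whose tree edge $(i,j)$ has capacity equal to the number of edges of $G$ leaving $S_j$, together with unit flows $f_{uv}$ in $G$ from $u$ to $v$ for each ordered pair (with $f_{uv}(x,y)=-f_{uv}(y,x)$), such that demands routable on $R$ with load at most $c(i,j)/\alpha_G$ on each tree edge yield, via the $f_{uv}$, total flow at most $1$ on each edge of $G$. $T$ is the binary decomposition obtained from $R$ by repeatedly splitting a node $i$ with $p>2$ children $j_1,\dots,j_p$ ($w(h)=|S_{j_h}|/|S_i|$):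 if some $w(h)>1/4$, $j_h$ becomes one child and a new node with set $S_i\setminus S_{j_h}$ holding the remaining children the other; otherwise the children are split into two groups of total weight in $[1/4,3/4]$, each becoming the children of a new child of $i$ whose set is the union of the group. $I_T$ = internal nodes of $T$; $\ell(i),r(i)$ = left/right children. Set $\beta=1/(8\alpha_G)$. For $i\in I_T$: $\kappa_i(u,v)=\frac{\beta k}{|S_{\ell(i)}||S_{r(i)}|}$ if $u\in S_{\ell(i)},v\in S_{r(i)}$ and $0$ otherwise; $d_i(u)=-\beta k/|S_{\ell(i)}|$ for $u\in S_{\ell(i)}$, $d_i(v)=\beta k/|S_{r(i)}|$ for $v\in S_{r(i)}$, $d_i(w)=0$ for $w\notin S_i$; $g_i(x,y)=\sum_{u,v}f_{uv}(x,y)\kappa_i(u,v)$ for each ordered pair $(x,y)$ with $\{x,y\}\in E$. For an edge $e=(x,y)$: $\sigma_e(i)=\mathrm{sgn}(g_i(x,y))$, $p_e(i)=|g_i(x,y)|$, $p_e(\emptyset)=1-\sum_{i\in I_T}p_e(i)$ (this is a probability distribution on $I_T\cup\{\emptyset\}$). Allocation strategy at time $t+1$: when edge $e=(x,y)$ is requested, sample $i\in I_T\cup\{\emptyset\}$ with probability $p_e(i)$; if $i=\emptyset$ place the ball on a uniformly random endpoint; otherwise, if $\sigma_e(i)(\overline L^t(S_{\ell(i)})-\overline L^t(S_{r(i)}))>0$ place it on $y$, if $<0$ on $x$, and if $=0$ on a uniformly random endpoint (the outcome does not depend on the orientation of $e$). For a load vector $L=L^t$ and $i\in I_T$: $Q_L(i)=+1$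 if $\overline L^t(S_{\ell(i)})>\overline L^t(S_{r(i)})$, $-1$ if $<$, and $0$ if equal.
   Formalization: The unit flows $f_{uv}$ and the congestion ratio $\alpha_G$ of the Räcke decomposition take rational values. -}

module Defs where

open import Data.Bool using (Bool; true; false; _∧_; not; _xor_; if_then_else_)
open import Data.Nat as ℕ using (ℕ; zero; suc; _<ᵇ_)
open import Data.Integer using (+_; +[1+_]; -[1+_])
open import Data.Fin using (Fin; toℕ; _≟_)
open import Data.Fin.Subset using (Subset; ⁅_⁆; _∪_; _─_; ∣_∣; Nonempty; ∁; ⊥; ⊤)
open import Data.Vec using (lookup)
open import Data.List using (List; []; _∷_; _++_; length; foldr; map)
open import Data.List.Relation.Unary.All using (All)
open import Data.List.Relation.Unary.AllPairs using (AllPairs)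
open import Data.List.Relation.Binary.Permutation.Propositional using (_↭_)
open import Data.Product using (_×_; ∃; Σ; _,_)
open import Data.Rational using (ℚ; mkℚ; 0ℚ; 1ℚ; ½; _+_; _*_; _-_; -_; _≤_; _≤ᵇ_; _/_; 1/_)
open import Data.Rational using () renaming (∣_∣ to absℚ)
open import Relation.Nullary using (does)
open import Relation.Binary.PropositionalEquality using (_≡_)

sumF : ∀ {n} → (Fin n → ℚ) → ℚ
sumF {zero}  f = 0ℚ
sumF {suc n} f = f Data.Fin.zero + sumF (λ i → f (Data.Fin.suc i))

sumPairs : ∀ {n} → (Fin n → Fin n → ℚ) → ℚ
sumPairs F = sumF (λ u → sumF (λ v → F u v))

sumℕ : ∀ {n} → (Fin n → ℕ) → ℕ
sumℕ {zero}  f = 0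
sumℕ {suc n} f = f Data.Fin.zero ℕ.+ sumℕ (λ i → f (Data.Fin.suc i))

count : ∀ {n} → (Fin n → Bool) → ℕ
count p = sumℕ (λ i → if p i then 1 else 0)

countPairs : ∀ {n} → (Fin n → Fin n → Bool) → ℕ
countPairs p = sumℕ (λ u → count (p u))

ℕtoℚ : ℕ → ℚ
ℕtoℚ k = + k / 1

-- p / k for a natural k; convention p / 0 = 0 (never used with k = 0
-- in the statement, since all sets involved are nonempty and m ≥ 1)
divℕ : ℚ → ℕ → ℚ
divℕ p zero    = 0ℚ
divℕ p (suc k) = p * (+ 1 / suc k)

-- 1/q, with the convention 1/0 = 0 (only used with q = 8α ≥ 8)
invℚ : ℚ → ℚ
invℚ p@(mkℚ (+ zero) _ _)     = 0ℚ
invℚ p@(mkℚ +[1+ _ ] _ _)     = 1/ p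
invℚ p@(mkℚ -[1+ _ ] _ _)     = 1/ p

sgn : ℚ → ℚ
sgn p = if p ≤ᵇ 0ℚ then (if 0ℚ ≤ᵇ p then 0ℚ else - 1ℚ) else 1ℚ

δ : ∀ {n} → Fin n → Fin n → ℚ
δ u w = if does (u ≟ w) then 1ℚ else 0ℚ

Graph : ℕ → Set
Graph n = Fin n → Fin n → Bool

inS : ∀ {n} → Subset n → Fin n → Bool
inS S x = lookup S x

IsSimpleGraph : ∀ {n} → Graph n → Set
IsSimpleGraph {n} G = ((x y : Fin n) → G x y ≡ G y x) × ((x : Fin n) → G x x ≡ false)

degree : ∀ {n} → Graph n → Fin n → ℕ
degree G v = count (G v)

IsRegular : ∀ {n} → Graph n → ℕ → Set
IsRegular G d = ∀ v → degree G v ≡ d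

edgeCount : ∀ {n} → Graph n → ℕ
edgeCount G = countPairs (λ x y → G x y ∧ (toℕ x <ᵇ toℕ y))

cut : ∀ {n} → Graph n → Subset n → ℕ
cut G S = countPairs (λ x y → G x y ∧ inS S x ∧ not (inS S y))

EdgeConnectivity : ∀ {n} → Graph n → ℕ → Set
EdgeConnectivity {n} G k =
  ((S : Subset n) → Nonempty S → Nonempty (∁ S) → k ℕ.≤ cut G S)
  × (∃ λ (S : Subset n) → Nonempty S × Nonempty (∁ S) × cut G S ≡ k)

-- Flows: f x y is the flow on the ordered pair (x,y)

IsUnitFlow : ∀ {n} → Graph n → (Fin n → Fin n → ℚ) → Fin n → Fin n → Set
IsUnitFlow {n} G φ u v =
  ((x y : Fin n) → φ x y ≡ - φ y x)
  × ((x y : Fin n) → G x y ≡ false → φ x y ≡ 0ℚ)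
  × ((w : Fin n) → sumF (φ w) ≡ δ u w - δ v w)

data HTree (n : ℕ) : Set where
  hnode : Subset n → List (HTree n) → HTree n

setH : ∀ {n} → HTree n → Subset n
setH (hnode S _) = S

Disjoint : ∀ {n} → Subset n → Subset n → Set
Disjoint A B = Data.Fin.Subset._∩_ A B ≡ ⊥

unions : ∀ {n} → List (HTree n) → Subset n
unions cs = foldr _∪_ ⊥ (map setH cs)

sizes : ∀ {n} → List (HTree n) → ℕ
sizes cs = foldr ℕ._+_ 0 (map (λ c → ∣ setH c ∣) cs)

data IsHD {n : ℕ} : HTree n → Set where
  hd-leaf : ∀ {S} (v : Fin n) → S ≡ ⁅ v ⁆ → IsHD (hnode S [])
  hd-node : ∀ {S c cs} →
            AllPairs Disjoint (map setH (c ∷ cs)) →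
            unions (c ∷ cs) ≡ S →
            All IsHD (c ∷ cs) →
            IsHD (hnode S (c ∷ cs))

mutual
  treeEdges : ∀ {n} → HTree n → List (Subset n × Subset n)
  treeEdges (hnode S cs) = map (λ c → (S , setH c)) cs ++ treeEdgesL cs

  treeEdgesL : ∀ {n} → List (HTree n) → List (Subset n × Subset n)
  treeEdgesL []       = []
  treeEdgesL (c ∷ cs) = treeEdges c ++ treeEdgesL cs

WellBalanced : ∀ {n} → HTree n → Set
WellBalanced R = All (λ { (P , C) → 4 ℕ.* ∣ C ∣ ℕ.≤ 3 ℕ.* ∣ P ∣ }) (treeEdges R)

sep : ∀ {n} → Subset n → Fin n → Fin n → Bool
sep C u v = inS C u xor inS C v

-- Räcke decomposition with congestion ratio α: tree R (edge (i,j) has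
-- capacity cut G S_j) and unit flows f u v from u to v such that every
-- (nonnegative) demand D whose tree routing puts load ≤ c(i,j)/α on each
-- tree edge is routed by the f u v with total flow ≤ 1 on each edge of G.
IsRacke : ∀ {n} → Graph n → ℚ → HTree n → (Fin n → Fin n → Fin n → Fin n → ℚ) → Set
IsRacke {n} G α R f =
  (1ℚ ≤ α)
  × IsHD R
  × (setH R ≡ ⊤)
  × WellBalanced R
  × ((u v : Fin n) → IsUnitFlow G (f u v) u v)
  × ((D : Fin n → Fin n → ℚ) → ((u v : Fin n) → 0ℚ ≤ D u v) →
     All (λ { (P , C) → α * sumPairs (λ u v → if sep C u v then D u v else 0ℚ)
                          ≤ ℕtoℚ (cut G C) }) (treeEdges R) →
     (x y : Fin n) → G x y ≡ true →
     sumPairs (λ u v → D u v * absℚ (f u v x y)) ≤ 1ℚ)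

data BTree (n : ℕ) : Set where
  bleaf : Fin n → BTree n
  bnode : BTree n → BTree n → BTree n

setB : ∀ {n} → BTree n → Subset n
setB (bleaf v)   = ⁅ v ⁆
setB (bnode l r) = setB l ∪ setB r

-- sum over internal nodes i ∈ I_T of F (S_ℓ(i)) (S_r(i))
sumI : ∀ {n} → BTree n → (Subset n → Subset n → ℚ) → ℚ
sumI (bleaf _)   F = 0ℚ
sumI (bnode l r) F = F (setB l) (setB r) + sumI l F + sumI r F

-- Binarize R T : T is obtained from R by the splitting procedure.
-- Split S cs t : the node with set S and children cs becomes the binary tree t.
mutual
  data Binarize {n : ℕ} : HTree n → BTree n → Set where
    bin-leaf : ∀ {S} (v : Fin n) → S ≡ ⁅ v ⁆ → Binarize (hnode S []) (bleaf v)
    bin-node : ∀ {S c cs t} → Split S (c ∷ cs) t → Binarize (hnode S (c ∷ cs)) t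

  data Split {n : ℕ} : Subset n → List (HTree n) → BTree n → Set where
    -- a (new) node with a single child is identified with that child
    split-one   : ∀ {S c t} → Binarize c t → Split S (c ∷ []) t
    split-two   : ∀ {S c₁ c₂ t₁ t₂} → Binarize c₁ t₁ → Binarize c₂ t₂ →
                  Split S (c₁ ∷ c₂ ∷ []) (bnode t₁ t₂)
    split-heavy : ∀ {S cs c rest t t'} → 3 ℕ.≤ length cs → cs ↭ c ∷ rest →
                  ∣ S ∣ ℕ.< 4 ℕ.* ∣ setH c ∣ →
                  Binarize c t → Split (S ─ setH c) rest t' →
                  Split S cs (bnode t t')
    split-bal   : ∀ {S cs g₁ g₂ t₁ t₂} → 3 ℕ.≤ length cs →
                  All (λ c → 4 ℕ.* ∣ setH c ∣ ℕ.≤ ∣ S ∣) cs →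
                  cs ↭ g₁ ++ g₂ →
                  ∣ S ∣ ℕ.≤ 4 ℕ.* sizes g₁ → 4 ℕ.* sizes g₁ ℕ.≤ 3 ℕ.* ∣ S ∣ →
                  Split (unions g₁) g₁ t₁ → Split (unions g₂) g₂ t₂ →
                  Split S cs (bnode t₁ t₂)
    -- which of the two parts is called left/right is arbitrary
    split-swap  : ∀ {S cs t₁ t₂} → Split S cs (bnode t₁ t₂) → Split S cs (bnode t₂ t₁)

module Strategy {n : ℕ} (G : Graph n) (f : Fin n → Fin n → Fin n → Fin n → ℚ)
                (α : ℚ) (k : ℕ) (T : BTree n) where

  β : ℚ
  β = invℚ (ℕtoℚ 8 * α)

  κ : Subset n → Subset n → Fin n → Fin n → ℚ
  κ Sl Sr u v = if inS Sl u ∧ inS Sr v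
                then divℕ (β * ℕtoℚ k) (∣ Sl ∣ ℕ.* ∣ Sr ∣) else 0ℚ

  dI : Subset n → Subset n → Fin n → ℚ
  dI Sl Sr w = if inS Sl w then - divℕ (β * ℕtoℚ k) ∣ Sl ∣
               else (if inS Sr w then divℕ (β * ℕtoℚ k) ∣ Sr ∣ else 0ℚ)

  g : Subset n → Subset n → Fin n → Fin n → ℚ
  g Sl Sr x y = sumPairs (λ u v → f u v x y * κ Sl Sr u v)

  avg : (Fin n → ℕ) → Subset n → ℚ
  avg L S = divℕ (ℕtoℚ (sumℕ (λ v → if inS S v then L v else 0))) ∣ S ∣

  Q : (Fin n → ℕ) → Subset n → Subset n → ℚ
  Q L Sl Sr = sgn (avg L Sl - avg L Sr)

  -- probability that the ball lands on w when edge (x,y) is requested and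
  -- the decision value is s: s > 0 → y, s < 0 → x, s = 0 → uniform endpoint
  dest : Fin n → Fin n → Fin n → ℚ → ℚ
  dest w x y s = if 0ℚ ≤ᵇ s
                 then (if s ≤ᵇ 0ℚ then ½ * (δ x w + δ y w) else δ y w)
                 else δ x w

  m : ℕ
  m = edgeCount G

  -- probability, given load vector L, of placing the ball on w when the
  -- requested edge is (x,y): sample i with prob. p_e(i), then decide
  probEdge : (Fin n → ℕ) → Fin n → Fin n → Fin n → ℚ
  probEdge L w x y =
      (1ℚ - sumI T (λ Sl Sr → absℚ (g Sl Sr x y))) * dest w x y 0ℚ
    + sumI T (λ Sl Sr → absℚ (g Sl Sr x y)
                         * dest w x y (sgn (g Sl Sr x y) * (avg L Sl - avg L Sr)))

  -- probability that the ball at the next step is placed on w, given that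
  -- the current load vector is L (edge uniform among the m edges {x,y}, x < y)
  stepProb : (Fin n → ℕ) → Fin n → ℚ
  stepProb L w = sumPairs (λ x y →
    if G x y ∧ (toℕ x <ᵇ toℕ y) then divℕ 1ℚ m * probEdge L w x y else 0ℚ)

-- Given the loads, the requested edge {x,y} is uniform, and for a sampled node i the ball lands on
-- y with probability ½ + ½ sgn(σ_e(i) D_i), D_i = L̄(S_ℓ(i)) − L̄(S_r(i)). As |g| sgn(sgn g · D) = g sgn D,
-- averaging over i (the ∅ outcome contributing ½ each) gives ½(δ_x + δ_y) + ½(δ_y − δ_x) P(x,y) with
-- P(x,y) = Σ_i g_i(x,y) Q_L(i). Summed over the m edges, the first term is d/2m = 1/n by regularity.
-- P is antisymmetric and vanishes off E, so the second term is (1/2m) Σ_x P(x,y), and flow conservation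
-- turns Σ_x g_i(x,y) into the net κ_i-demand at y, which is d_i(y) because S_ℓ(i) and S_r(i) are disjoint
-- and nonempty; disjointness is inherited from the partition R through every splitting step.

module Submission where

open import Defs
open import Data.Nat using (ℕ; _≤_) renaming (_*_ to _*ℕ_)
open import Data.Fin using (Fin)
open import Data.Rational using (ℚ; 1ℚ; _+_; _*_)
open import Relation.Binary.PropositionalEquality using (_≡_)

open import Data.Nat using (zero; suc; _<_; _<ᵇ_) renaming (_+_ to _+ℕ_)
import Data.Nat.Properties as ℕP
import Data.Nat.Coprimality as Coprime
import Data.Integer as ℤ
import Data.Integer.Properties as ℤP
open import Data.Fin using (toℕ) renaming (zero to fzero; suc to fsuc)
import Data.Fin.Properties as FinP
open import Data.Fin.Subset using (Subset; ∣_∣; _∈_; _⊆_; _∩_; Nonempty; Empty)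
import Data.Fin.Subset.Properties as SubsetP
open import Data.Bool using (Bool; true; false; if_then_else_; _∧_; not)
open import Data.Bool.Properties using (T-≡; ∧-identityʳ; ∧-zeroʳ)
import Data.Rational as ℚ
open import Data.Rational using (mkℚ; 0ℚ; ½; -_; _-_; _/_; _≤ᵇ_) renaming (∣_∣ to ∣_∣ℚ)
import Data.Rational.Properties as ℚP
open import Data.Rational.Solver using (module +-*-Solver)
open import Data.Vec as Vec using (_∷_; [])
open import Data.Vec.Properties using (lookup⇒[]=)
open import Data.List using (List; []; _∷_; _++_)
open import Data.List.Relation.Unary.All as All using (All; []; _∷_)
import Data.List.Relation.Unary.All.Properties as AllP
open import Data.List.Relation.Unary.Any using (Any; here; there)
import Data.List.Relation.Unary.Any.Properties as AnyP
open import Data.List.Relation.Unary.AllPairs as AllPairs using (AllPairs; []; _∷_)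
import Data.List.Relation.Unary.AllPairs.Properties as AllPairsP
open import Data.List.Relation.Binary.Permutation.Propositional using (_↭_; ↭-sym; ↭⇒↭ₛ)
import Data.List.Relation.Binary.Permutation.Propositional.Properties as PermP
import Data.List.Relation.Binary.Permutation.Setoid.Properties as PermₛP
open import Data.Product using (∃; _×_; _,_; proj₁; proj₂)
open import Data.Sum using (inj₁; inj₂)
open import Data.Unit using (⊤; tt)
open import Data.Empty using (⊥; ⊥-elim)
open import Function using (_∘_; Equivalence)
open import Relation.Nullary using (¬_; contradiction)
open import Relation.Binary.Definitions using (tri<; tri≈; tri>)
open import Relation.Binary.PropositionalEquality
  using (_≢_; refl; sym; trans; cong; cong₂; subst; setoid; module ≡-Reasoning)

open +-*-Solver

ℕtoℚ-mkℚ : ∀ a → ℕtoℚ a ≡ mkℚ (ℤ.+ a) 0 (Coprime.sym (Coprime.1-coprimeTo a))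
ℕtoℚ-mkℚ a = ℚP.normalize-coprime (Coprime.sym (Coprime.1-coprimeTo a))

ℕtoℚ-+ : ∀ a b → ℕtoℚ (a +ℕ b) ≡ ℕtoℚ a + ℕtoℚ b
ℕtoℚ-+ a b = begin
  ℤ.+ (a +ℕ b) / 1
    ≡⟨ cong (_/ 1) (cong₂ ℤ._+_ (sym (ℤP.*-identityʳ (ℤ.+ a))) (sym (ℤP.*-identityʳ (ℤ.+ b)))) ⟩
  (ℤ.+ a ℤ.* ℤ.+ 1 ℤ.+ ℤ.+ b ℤ.* ℤ.+ 1) / 1
    ≡⟨ sym (cong₂ _+_ (ℕtoℚ-mkℚ a) (ℕtoℚ-mkℚ b)) ⟩
  ℕtoℚ a + ℕtoℚ b ∎
  where open ≡-Reasoning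

ℕtoℚ-* : ∀ a b → ℕtoℚ (a *ℕ b) ≡ ℕtoℚ a * ℕtoℚ b
ℕtoℚ-* zero    b = sym (ℚP.*-zeroˡ (ℕtoℚ b))
ℕtoℚ-* (suc a) b = begin
  ℕtoℚ (b +ℕ a *ℕ b)        ≡⟨ trans (ℕtoℚ-+ b (a *ℕ b)) (cong (ℕtoℚ b +_) (ℕtoℚ-* a b)) ⟩
  ℕtoℚ b + ℕtoℚ a * ℕtoℚ b  ≡⟨ solve 2 (λ x y → y :+ x :* y := (con 1ℚ :+ x) :* y) refl (ℕtoℚ a) (ℕtoℚ b) ⟩
  (1ℚ + ℕtoℚ a) * ℕtoℚ b    ≡⟨ cong (_* ℕtoℚ b) (sym (ℕtoℚ-+ 1 a)) ⟩
  ℕtoℚ (suc a) * ℕtoℚ b     ∎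
  where open ≡-Reasoning

ℕtoℚ-suc≢0 : ∀ j → ℕtoℚ (suc j) ≢ 0ℚ
ℕtoℚ-suc≢0 j eq with trans (sym (ℕtoℚ-mkℚ (suc j))) eq
... | ()

divℕ-cancelʳ : ∀ c j → divℕ c (suc j) * ℕtoℚ (suc j) ≡ c
divℕ-cancelʳ c j = begin
  c * (ℤ.+ 1 / suc j) * ℕtoℚ (suc j)     ≡⟨ ℚP.*-assoc c _ _ ⟩
  c * ((ℤ.+ 1 / suc j) * ℕtoℚ (suc j))   ≡⟨ cong (c *_) 1/n*n≡1 ⟩
  c * 1ℚ                               ≡⟨ ℚP.*-identityʳ c ⟩
  c                                    ∎
  where
  open ≡-Reasoning
  1/n*n≡1 : (ℤ.+ 1 / suc j) * ℕtoℚ (suc j) ≡ 1ℚ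
  1/n*n≡1 = trans (cong₂ _*_ (ℚP.normalize-coprime (Coprime.1-coprimeTo (suc j))) (ℕtoℚ-mkℚ (suc j)))
                  (ℚP.*-inverseˡ (mkℚ (ℤ.+ suc j) 0 (Coprime.sym (Coprime.1-coprimeTo (suc j)))))

divℕ-unique : ∀ c j {x} → x * ℕtoℚ (suc j) ≡ c → x ≡ divℕ c (suc j)
divℕ-unique c j {x} x*n≡c = begin
  x                          ≡⟨ sym (divℕ-cancelʳ x j) ⟩
  divℕ x (suc j) * N         ≡⟨ solve 3 (λ x i n → x :* i :* n := x :* n :* i) refl x (ℤ.+ 1 / suc j) N ⟩
  x * N * (ℤ.+ 1 / suc j)      ≡⟨ cong (_* (ℤ.+ 1 / suc j)) x*n≡c ⟩
  divℕ c (suc j)             ∎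
  where
  open ≡-Reasoning
  N = ℕtoℚ (suc j)

ℕtoℚ*divℕ-cancelˡ : ∀ c i j → ℕtoℚ (suc i) * divℕ c (suc i *ℕ suc j) ≡ divℕ c (suc j)
ℕtoℚ*divℕ-cancelˡ c i j = divℕ-unique c j (begin
  I * X * J         ≡⟨ solve 3 (λ i x j → i :* x :* j := x :* (i :* j)) refl I X J ⟩
  X * (I * J)       ≡⟨ cong (X *_) (sym (ℕtoℚ-* (suc i) (suc j))) ⟩
  X * ℕtoℚ (suc i *ℕ suc j) ≡⟨ divℕ-cancelʳ c (j +ℕ i *ℕ suc j) ⟩
  c                 ∎)
  where
  open ≡-Reasoning
  I = ℕtoℚ (suc i)
  J = ℕtoℚ (suc j)
  X = divℕ c (suc i *ℕ suc j)

divℕ-½ : ∀ c m → divℕ c (suc m) * ½ ≡ divℕ c (2 *ℕ suc m)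
divℕ-½ c m = divℕ-unique c (m +ℕ suc (m +ℕ 0)) (begin
  X * ½ * ℕtoℚ (2 *ℕ suc m)   ≡⟨ cong (X * ½ *_) (ℕtoℚ-* 2 (suc m)) ⟩
  X * ½ * (ℕtoℚ 2 * M)        ≡⟨ solve 2 (λ x m → x :* con ½ :* (con (ℕtoℚ 2) :* m) := x :* m) refl X M ⟩
  X * M                       ≡⟨ divℕ-cancelʳ c m ⟩
  c                           ∎)
  where
  open ≡-Reasoning
  M = ℕtoℚ (suc m)
  X = divℕ c (suc m)

≤⇒≤ᵇ≡true : ∀ {p q} → p ℚ.≤ q → (p ≤ᵇ q) ≡ true
≤⇒≤ᵇ≡true p≤q = Equivalence.to T-≡ (ℚP.≤⇒≤ᵇ p≤q)

>⇒≤ᵇ≡false : ∀ {p q} → q ℚ.< p → (p ≤ᵇ q) ≡ false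
>⇒≤ᵇ≡false {p} {q} q<p with p ≤ᵇ q in p≤ᵇq
... | false = refl
... | true  = contradiction (ℚP.<-≤-trans q<p (ℚP.≤ᵇ⇒≤ (Equivalence.from T-≡ p≤ᵇq))) (ℚP.<-irrefl refl)

pos⇒sgn≡1 : ∀ {p} → 0ℚ ℚ.< p → sgn p ≡ 1ℚ
pos⇒sgn≡1 0<p rewrite >⇒≤ᵇ≡false 0<p = refl

neg⇒sgn≡-1 : ∀ {p} → p ℚ.< 0ℚ → sgn p ≡ - 1ℚ
neg⇒sgn≡-1 p<0 rewrite ≤⇒≤ᵇ≡true (ℚP.<⇒≤ p<0) | >⇒≤ᵇ≡false p<0 = refl

sgn-neg : ∀ p → sgn (- p) ≡ - sgn p
sgn-neg p with ℚP.<-cmp 0ℚ p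
... | tri< 0<p _ _ = trans (neg⇒sgn≡-1 (ℚP.neg-antimono-< 0<p)) (cong -_ (sym (pos⇒sgn≡1 0<p)))
... | tri≈ _ refl _ = refl
... | tri> _ _ p<0 = trans (pos⇒sgn≡1 (ℚP.neg-antimono-< p<0)) (cong -_ (sym (neg⇒sgn≡-1 p<0)))

∣p∣*sgn[sgn[p]*q]≡p*sgn[q] : ∀ p q → ∣ p ∣ℚ * sgn (sgn p * q) ≡ p * sgn q
∣p∣*sgn[sgn[p]*q]≡p*sgn[q] p q with ℚP.<-cmp 0ℚ p
... | tri< 0<p _ _ rewrite pos⇒sgn≡1 0<p | ℚP.*-identityˡ q | ℚP.0≤p⇒∣p∣≡p (ℚP.<⇒≤ 0<p) = refl
... | tri≈ _ refl _ = trans (ℚP.*-zeroˡ (sgn (sgn 0ℚ * q))) (sym (ℚP.*-zeroˡ (sgn q)))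
... | tri> _ _ p<0 rewrite neg⇒sgn≡-1 p<0 = begin
  ∣ p ∣ℚ * sgn (- 1ℚ * q)  ≡⟨ cong (λ r → ∣ p ∣ℚ * sgn r) (solve 1 (λ x → con (- 1ℚ) :* x := :- x) refl q) ⟩
  ∣ p ∣ℚ * sgn (- q)       ≡⟨ cong₂ _*_ ∣p∣≡-p (sgn-neg q) ⟩
  (- p) * (- sgn q)        ≡⟨ solve 2 (λ x y → (:- x) :* (:- y) := x :* y) refl p (sgn q) ⟩
  p * sgn q                ∎
  where
  open ≡-Reasoning
  ∣p∣≡-p : ∣ p ∣ℚ ≡ - p
  ∣p∣≡-p = trans (sym (ℚP.∣-p∣≡∣p∣ p)) (ℚP.0≤p⇒∣p∣≡p (ℚP.<⇒≤ (ℚP.neg-antimono-< p<0)))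

sumF-cong : ∀ {n} {f g : Fin n → ℚ} → (∀ i → f i ≡ g i) → sumF f ≡ sumF g
sumF-cong {zero}  f≗g = refl
sumF-cong {suc n} f≗g = cong₂ _+_ (f≗g fzero) (sumF-cong (λ i → f≗g (fsuc i)))

sumF-zero : ∀ {n} {f : Fin n → ℚ} → (∀ i → f i ≡ 0ℚ) → sumF f ≡ 0ℚ
sumF-zero {zero}  f≗0 = refl
sumF-zero {suc n} f≗0 = cong₂ _+_ (f≗0 fzero) (sumF-zero (λ i → f≗0 (fsuc i)))

sumF-+ : ∀ {n} (f g : Fin n → ℚ) → sumF (λ i → f i + g i) ≡ sumF f + sumF g
sumF-+ {zero}  f g = refl
sumF-+ {suc n} f g =
  trans (cong (f fzero + g fzero +_) (sumF-+ (λ i → f (fsuc i)) (λ i → g (fsuc i))))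
        (solve 4 (λ a b c d → (a :+ b) :+ (c :+ d) := (a :+ c) :+ (b :+ d)) refl (f fzero) (g fzero) _ _)

sumF-*ˡ : ∀ {n} c (f : Fin n → ℚ) → sumF (λ i → c * f i) ≡ c * sumF f
sumF-*ˡ {zero}  c f = sym (ℚP.*-zeroʳ c)
sumF-*ˡ {suc n} c f =
  trans (cong (c * f fzero +_) (sumF-*ˡ c (λ i → f (fsuc i)))) (sym (ℚP.*-distribˡ-+ c _ _))

sumF-*ʳ : ∀ {n} c (f : Fin n → ℚ) → sumF (λ i → f i * c) ≡ sumF f * c
sumF-*ʳ c f = trans (sumF-cong (λ i → ℚP.*-comm (f i) c)) (trans (sumF-*ˡ c f) (ℚP.*-comm c _))

sumF-neg : ∀ {n} (f : Fin n → ℚ) → sumF (λ i → - f i) ≡ - sumF f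
sumF-neg f = trans (sumF-cong (λ i → solve 1 (λ a → :- a := con (- 1ℚ) :* a) refl (f i)))
            (trans (sumF-*ˡ (- 1ℚ) f) (solve 1 (λ a → con (- 1ℚ) :* a := :- a) refl (sumF f)))

sumF-- : ∀ {n} (f g : Fin n → ℚ) → sumF (λ i → f i - g i) ≡ sumF f - sumF g
sumF-- f g = trans (sumF-+ f (λ i → - g i)) (cong (sumF f +_) (sumF-neg g))

sumF-comm : ∀ {m n} (H : Fin m → Fin n → ℚ) →
            sumF (λ x → sumF (H x)) ≡ sumF (λ y → sumF (λ x → H x y))
sumF-comm {zero}  H = sym (sumF-zero {f = λ y → sumF (λ x → H x y)} (λ _ → refl))
sumF-comm {suc m} H = trans (cong (sumF (H fzero) +_) (sumF-comm (λ x → H (fsuc x))))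
                            (sym (sumF-+ (H fzero) _))

sumF-δ : ∀ {n} (y : Fin n) (c : Fin n → ℚ) → sumF (λ x → δ x y * c x) ≡ c y
sumF-δ fzero c = trans (cong₂ _+_ (ℚP.*-identityˡ (c fzero)) (sumF-zero (λ i → ℚP.*-zeroˡ (c (fsuc i)))))
                       (ℚP.+-identityʳ (c fzero))
sumF-δ (fsuc y) c = trans (cong₂ _+_ (ℚP.*-zeroˡ (c fzero)) (sumF-δ y (λ i → c (fsuc i))))
                          (ℚP.+-identityˡ (c (fsuc y)))

sumF-const : ∀ n c → sumF {n} (λ _ → c) ≡ ℕtoℚ n * c
sumF-const zero    c = sym (ℚP.*-zeroˡ c)
sumF-const (suc n) c = begin
  c + sumF {n} (λ _ → c)  ≡⟨ cong (c +_) (sumF-const n c) ⟩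
  c + ℕtoℚ n * c          ≡⟨ solve 2 (λ a b → b :+ a :* b := (con 1ℚ :+ a) :* b) refl (ℕtoℚ n) c ⟩
  (1ℚ + ℕtoℚ n) * c       ≡⟨ cong (_* c) (sym (ℕtoℚ-+ 1 n)) ⟩
  ℕtoℚ (suc n) * c        ∎
  where open ≡-Reasoning

𝟙 : Bool → ℚ
𝟙 b = if b then 1ℚ else 0ℚ

if-then-0≡𝟙* : ∀ b (a : ℚ) → (if b then a else 0ℚ) ≡ 𝟙 b * a
if-then-0≡𝟙* true  a = sym (ℚP.*-identityˡ a)
if-then-0≡𝟙* false a = sym (ℚP.*-zeroˡ a)

𝟙-∧ : ∀ a b → 𝟙 (a ∧ b) ≡ 𝟙 a * 𝟙 b
𝟙-∧ true  b = sym (ℚP.*-identityˡ (𝟙 b))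
𝟙-∧ false b = sym (ℚP.*-zeroˡ (𝟙 b))

ℕtoℚ-sumℕ : ∀ {n} (f : Fin n → ℕ) → ℕtoℚ (sumℕ f) ≡ sumF (λ i → ℕtoℚ (f i))
ℕtoℚ-sumℕ {zero}  f = refl
ℕtoℚ-sumℕ {suc n} f = trans (ℕtoℚ-+ (f fzero) _) (cong (ℕtoℚ (f fzero) +_) (ℕtoℚ-sumℕ (λ i → f (fsuc i))))

ℕtoℚ-count : ∀ {n} (p : Fin n → Bool) → ℕtoℚ (count p) ≡ sumF (λ i → 𝟙 (p i))
ℕtoℚ-count p = trans (ℕtoℚ-sumℕ (λ i → if p i then 1 else 0)) (sumF-cong (λ i → ℕtoℚ-𝟙 (p i)))
  where
  ℕtoℚ-𝟙 : ∀ b → ℕtoℚ (if b then 1 else 0) ≡ 𝟙 b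
  ℕtoℚ-𝟙 true  = refl
  ℕtoℚ-𝟙 false = refl

ℕtoℚ-countPairs : ∀ {n} (p : Fin n → Fin n → Bool) → ℕtoℚ (countPairs p) ≡ sumPairs (λ x y → 𝟙 (p x y))
ℕtoℚ-countPairs p = trans (ℕtoℚ-sumℕ (λ x → count (p x))) (sumF-cong (λ x → ℕtoℚ-count (p x)))

ℕtoℚ-∣∣ : ∀ {n} (S : Subset n) → ℕtoℚ ∣ S ∣ ≡ sumF (λ v → 𝟙 (inS S v))
ℕtoℚ-∣∣ []          = refl
ℕtoℚ-∣∣ (true ∷ S)  = trans (ℕtoℚ-+ 1 ∣ S ∣) (cong (1ℚ +_) (ℕtoℚ-∣∣ S))
ℕtoℚ-∣∣ (false ∷ S) = trans (ℕtoℚ-∣∣ S) (sym (ℚP.+-identityˡ _))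

∣∣≡suc : ∀ {n} {S : Subset n} {w} → w ∈ S → ∃ λ j → ∣ S ∣ ≡ suc j
∣∣≡suc {S = true ∷ S}  _               = _ , refl
∣∣≡suc {S = false ∷ S} (Vec.there w∈S) = ∣∣≡suc w∈S

sumPairs-cong : ∀ {n} {F H : Fin n → Fin n → ℚ} → (∀ x y → F x y ≡ H x y) → sumPairs F ≡ sumPairs H
sumPairs-cong F≗H = sumF-cong (λ x → sumF-cong (F≗H x))

sumPairs-+ : ∀ {n} (F H : Fin n → Fin n → ℚ) → sumPairs (λ x y → F x y + H x y) ≡ sumPairs F + sumPairs H
sumPairs-+ F H = trans (sumF-cong (λ x → sumF-+ (F x) (H x))) (sumF-+ (λ x → sumF (F x)) (λ x → sumF (H x)))

sumPairs-*ˡ : ∀ {n} c (F : Fin n → Fin n → ℚ) → sumPairs (λ x y → c * F x y) ≡ c * sumPairs F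
sumPairs-*ˡ c F = trans (sumF-cong (λ x → sumF-*ˡ c (F x))) (sumF-*ˡ c (λ x → sumF (F x)))

sumPairs-neg : ∀ {n} (F : Fin n → Fin n → ℚ) → sumPairs (λ x y → - F x y) ≡ - sumPairs F
sumPairs-neg F = trans (sumF-cong (λ x → sumF-neg (F x))) (sumF-neg (λ x → sumF (F x)))

sumI-cong : ∀ {n} (t : BTree n) {F H : Subset n → Subset n → ℚ} →
            (∀ a b → F a b ≡ H a b) → sumI t F ≡ sumI t H
sumI-cong (bleaf _)   F≗H = refl
sumI-cong (bnode l r) F≗H = cong₂ _+_ (cong₂ _+_ (F≗H _ _) (sumI-cong l F≗H)) (sumI-cong r F≗H)

sumI-zero : ∀ {n} (t : BTree n) {F : Subset n → Subset n → ℚ} → (∀ a b → F a b ≡ 0ℚ) → sumI t F ≡ 0ℚ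
sumI-zero (bleaf _)   F≗0 = refl
sumI-zero (bnode l r) F≗0 = cong₂ _+_ (cong₂ _+_ (F≗0 _ _) (sumI-zero l F≗0)) (sumI-zero r F≗0)

sumI-+ : ∀ {n} (t : BTree n) (F H : Subset n → Subset n → ℚ) →
         sumI t (λ a b → F a b + H a b) ≡ sumI t F + sumI t H
sumI-+ (bleaf _)   F H = refl
sumI-+ (bnode l r) F H =
  trans (cong₂ _+_ (cong (F (setB l) (setB r) + H (setB l) (setB r) +_) (sumI-+ l F H)) (sumI-+ r F H))
        (solve 6 (λ a b c d e f → ((a :+ b) :+ (c :+ d)) :+ (e :+ f) := ((a :+ c) :+ e) :+ ((b :+ d) :+ f)) refl
               (F (setB l) (setB r)) (H (setB l) (setB r)) (sumI l F) (sumI l H) (sumI r F) (sumI r H))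

sumI-*ˡ : ∀ {n} (t : BTree n) c (F : Subset n → Subset n → ℚ) → sumI t (λ a b → c * F a b) ≡ c * sumI t F
sumI-*ˡ (bleaf _)   c F = sym (ℚP.*-zeroʳ c)
sumI-*ˡ (bnode l r) c F =
  trans (cong₂ _+_ (cong (c * F (setB l) (setB r) +_) (sumI-*ˡ l c F)) (sumI-*ˡ r c F))
        (solve 4 (λ c a b d → (c :* a :+ c :* b) :+ c :* d := c :* ((a :+ b) :+ d)) refl
               c (F (setB l) (setB r)) (sumI l F) (sumI r F))

sumI-*ʳ : ∀ {n} (t : BTree n) c (F : Subset n → Subset n → ℚ) → sumI t (λ a b → F a b * c) ≡ sumI t F * c
sumI-*ʳ t c F = trans (sumI-cong t (λ a b → ℚP.*-comm (F a b) c)) (trans (sumI-*ˡ t c F) (ℚP.*-comm c _))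

sumI-neg : ∀ {n} (t : BTree n) (F : Subset n → Subset n → ℚ) → sumI t (λ a b → - F a b) ≡ - sumI t F
sumI-neg t F = trans (sumI-cong t (λ a b → solve 1 (λ x → :- x := con (- 1ℚ) :* x) refl (F a b)))
              (trans (sumI-*ˡ t (- 1ℚ) F) (solve 1 (λ x → con (- 1ℚ) :* x := :- x) refl (sumI t F)))

sumF-sumI : ∀ {n} (t : BTree n) (F : Fin n → Subset n → Subset n → ℚ) →
            sumF (λ x → sumI t (F x)) ≡ sumI t (λ a b → sumF (λ x → F x a b))
sumF-sumI (bleaf v)   F = sumF-zero {f = λ x → sumI (bleaf v) (F x)} (λ _ → refl)
sumF-sumI (bnode l r) F =
  trans (sumF-+ (λ x → F x (setB l) (setB r) + sumI l (F x)) (λ x → sumI r (F x)))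
        (cong₂ _+_ (trans (sumF-+ (λ x → F x (setB l) (setB r)) (λ x → sumI l (F x)))
                          (cong (sumF (λ x → F x (setB l) (setB r)) +_) (sumF-sumI l F)))
                   (sumF-sumI r F))

setB-nonempty : ∀ {n} (t : BTree n) → Nonempty (setB t)
setB-nonempty (bleaf v)   = v , SubsetP.x∈⁅x⁆ v
setB-nonempty (bnode l r) with setB-nonempty l
... | w , w∈l = w , SubsetP.x∈p∪q⁺ (inj₁ w∈l)

DisjointChildren : ∀ {n} → BTree n → Set
DisjointChildren (bleaf _)   = ⊤
DisjointChildren (bnode l r) = Empty (setB l ∩ setB r) × DisjointChildren l × DisjointChildren r

sumI-cong-disjoint : ∀ {n} (t : BTree n) {F H : Subset n → Subset n → ℚ} → DisjointChildren t →
  (∀ a b → Empty (a ∩ b) → Nonempty a → Nonempty b → F a b ≡ H a b) → sumI t F ≡ sumI t H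
sumI-cong-disjoint (bleaf _)   _                    F≗H = refl
sumI-cong-disjoint (bnode l r) (l∩r≡∅ , disjˡ , disjʳ) F≗H =
  cong₂ _+_ (cong₂ _+_ (F≗H _ _ l∩r≡∅ (setB-nonempty l) (setB-nonempty r)) (sumI-cong-disjoint l disjˡ F≗H))
            (sumI-cong-disjoint r disjʳ F≗H)

-- Binarisation keeps sibling sets disjoint

module _ {n : ℕ} where

  private
    variable
      A B : Subset n
      w : Fin n
      c : HTree n
      cs ds : List (HTree n)
      t : BTree n
      S : Subset n

  ∩-empty : (∀ {w} → w ∈ A → w ∈ B → ⊥) → Empty (A ∩ B)
  ∩-empty {A} {B} A∩B≡∅ (w , w∈A∩B) with SubsetP.x∈p∩q⁻ A B w∈A∩B
  ... | w∈A , w∈B = A∩B≡∅ w∈A w∈B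

  ∩-empty⁻ : Empty (A ∩ B) → w ∈ A → w ∈ B → ⊥
  ∩-empty⁻ A∩B≡∅ w∈A w∈B = A∩B≡∅ (_ , SubsetP.x∈p∩q⁺ (w∈A , w∈B))

  ∩-empty-sym : Empty (A ∩ B) → Empty (B ∩ A)
  ∩-empty-sym A∩B≡∅ = ∩-empty (λ w∈B w∈A → ∩-empty⁻ A∩B≡∅ w∈A w∈B)

  Apart : HTree n → HTree n → Set
  Apart c d = Empty (setH c ∩ setH d)

  ∈-unions⁺ : Any ((w ∈_) ∘ setH) cs → w ∈ unions cs
  ∈-unions⁺ (here w∈c)   = SubsetP.x∈p∪q⁺ (inj₁ w∈c)
  ∈-unions⁺ (there w∈cs) = SubsetP.x∈p∪q⁺ (inj₂ (∈-unions⁺ w∈cs))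

  Any-apart : All (λ c → All (Apart c) ds) cs → Any ((w ∈_) ∘ setH) cs → Any ((w ∈_) ∘ setH) ds → ⊥
  Any-apart cs⊥ds w∈cs w∈ds =
    All.lookupWith (λ c⊥ds w∈c → All.lookupWith (λ c⊥d w∈d → ∩-empty⁻ c⊥d w∈c w∈d) c⊥ds w∈ds) cs⊥ds w∈cs

  AllPairs-++⁻ : ∀ {R : HTree n → HTree n → Set} cs → AllPairs R (cs ++ ds) →
                 AllPairs R cs × AllPairs R ds × All (λ c → All (R c) ds) cs
  AllPairs-++⁻ []       Rds            = [] , Rds , []
  AllPairs-++⁻ (c ∷ cs) (Rc ∷ Rcsds) with AllPairs-++⁻ cs Rcsds | AllP.++⁻ cs Rc
  ... | Rcs , Rds , Rcsds′ | Rccs , Rcds = Rccs ∷ Rcs , Rds , Rcds ∷ Rcsds′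

  AllPairs-Apart-resp-↭ : cs ↭ ds → AllPairs Apart cs → AllPairs Apart ds
  AllPairs-Apart-resp-↭ cs↭ds =
    PermₛP.AllPairs-resp-↭ (setoid (HTree n)) ∩-empty-sym ((λ { refl a → a }) , (λ { refl a → a })) (↭⇒↭ₛ cs↭ds)

  mutual
    binarize-⊆ : IsHD c → Binarize c t → setB t ⊆ setH c
    binarize-⊆ (hd-leaf _ _)          (bin-leaf v refl) w∈t = w∈t
    binarize-⊆ (hd-node _ refl all) (bin-node sp)     w∈t = ∈-unions⁺ (split-⊆ all sp w∈t)

    split-⊆ : All IsHD cs → Split S cs t → w ∈ setB t → Any ((w ∈_) ∘ setH) cs
    split-⊆ (h ∷ _) (split-one b) w∈t = here (binarize-⊆ h b w∈t)
    split-⊆ (h₁ ∷ h₂ ∷ []) (split-two b₁ b₂) w∈t with SubsetP.x∈p∪q⁻ _ _ w∈t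
    ... | inj₁ w∈t₁ = here (binarize-⊆ h₁ b₁ w∈t₁)
    ... | inj₂ w∈t₂ = there (here (binarize-⊆ h₂ b₂ w∈t₂))
    split-⊆ all (split-heavy _ perm _ b sp) w∈t with PermP.All-resp-↭ perm all | SubsetP.x∈p∪q⁻ _ _ w∈t
    ... | h ∷ hs | inj₁ w∈t₁ = PermP.Any-resp-↭ (↭-sym perm) (here (binarize-⊆ h b w∈t₁))
    ... | h ∷ hs | inj₂ w∈t₂ = PermP.Any-resp-↭ (↭-sym perm) (there (split-⊆ hs sp w∈t₂))
    split-⊆ all (split-bal {g₁ = g₁} _ _ perm _ _ sp₁ sp₂) w∈t
      with AllP.++⁻ g₁ (PermP.All-resp-↭ perm all) | SubsetP.x∈p∪q⁻ _ _ w∈t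
    ... | hs₁ , hs₂ | inj₁ w∈t₁ = PermP.Any-resp-↭ (↭-sym perm) (AnyP.++⁺ˡ (split-⊆ hs₁ sp₁ w∈t₁))
    ... | hs₁ , hs₂ | inj₂ w∈t₂ = PermP.Any-resp-↭ (↭-sym perm) (AnyP.++⁺ʳ g₁ (split-⊆ hs₂ sp₂ w∈t₂))
    split-⊆ all (split-swap sp) w∈t with SubsetP.x∈p∪q⁻ _ _ w∈t
    ... | inj₁ w∈t₂ = split-⊆ all sp (SubsetP.x∈p∪q⁺ (inj₂ w∈t₂))
    ... | inj₂ w∈t₁ = split-⊆ all sp (SubsetP.x∈p∪q⁺ (inj₁ w∈t₁))

  mutual
    binarize-disjoint : IsHD c → Binarize c t → DisjointChildren t
    binarize-disjoint (hd-leaf _ _)       (bin-leaf _ _) = tt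
    binarize-disjoint (hd-node ds _ all) (bin-node sp)  =
      split-disjoint all (AllPairs.map disjoint⇒empty (AllPairsP.map⁻ ds)) sp
      where
      disjoint⇒empty : Disjoint A B → Empty (A ∩ B)
      disjoint⇒empty A∩B≡⊥ (w , w∈A∩B) = SubsetP.∉⊥ (subst (w ∈_) A∩B≡⊥ w∈A∩B)

    split-disjoint : All IsHD cs → AllPairs Apart cs → Split S cs t → DisjointChildren t
    split-disjoint (h ∷ _) _ (split-one b) = binarize-disjoint h b
    split-disjoint (h₁ ∷ h₂ ∷ []) ((c₁⊥c₂ ∷ []) ∷ _) (split-two b₁ b₂) =
      ∩-empty (λ w∈t₁ w∈t₂ → ∩-empty⁻ c₁⊥c₂ (binarize-⊆ h₁ b₁ w∈t₁) (binarize-⊆ h₂ b₂ w∈t₂)) ,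
      binarize-disjoint h₁ b₁ , binarize-disjoint h₂ b₂
    split-disjoint all apart (split-heavy {c = c} _ perm _ b sp)
      with PermP.All-resp-↭ perm all | AllPairs-Apart-resp-↭ perm apart
    ... | h ∷ hs | c⊥rest ∷ apart-rest =
      ∩-empty (λ w∈t w∈t′ → Any-apart {cs = c ∷ []} (c⊥rest ∷ [])
                                        (here (binarize-⊆ h b w∈t)) (split-⊆ hs sp w∈t′)) ,
      binarize-disjoint h b , split-disjoint hs apart-rest sp
    split-disjoint all apart (split-bal {g₁ = g₁} _ _ perm _ _ sp₁ sp₂)
      with AllP.++⁻ g₁ (PermP.All-resp-↭ perm all) | AllPairs-++⁻ g₁ (AllPairs-Apart-resp-↭ perm apart)
    ... | hs₁ , hs₂ | apart₁ , apart₂ , g₁⊥g₂ =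
      ∩-empty (λ w∈t₁ w∈t₂ → Any-apart g₁⊥g₂ (split-⊆ hs₁ sp₁ w∈t₁) (split-⊆ hs₂ sp₂ w∈t₂)) ,
      split-disjoint hs₁ apart₁ sp₁ , split-disjoint hs₂ apart₂ sp₂
    split-disjoint all apart (split-swap sp) with split-disjoint all apart sp
    ... | t₁⊥t₂ , disj₁ , disj₂ = ∩-empty-sym t₁⊥t₂ , disj₂ , disj₁

-- Regular simple graphs

<⇒<ᵇ≡true : ∀ {m n} → m < n → (m <ᵇ n) ≡ true
<⇒<ᵇ≡true m<n = Equivalence.to T-≡ (ℕP.<⇒<ᵇ m<n)

≮⇒<ᵇ≡false : ∀ {m n} → ¬ m < n → (m <ᵇ n) ≡ false
≮⇒<ᵇ≡false {m} {n} m≮n with m <ᵇ n in m<ᵇn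
... | false = refl
... | true  = contradiction (ℕP.<ᵇ⇒< m n (Equivalence.from T-≡ m<ᵇn)) m≮n

sumℕ-zero : ∀ {n} {f : Fin n → ℕ} → (∀ i → f i ≡ 0) → sumℕ f ≡ 0
sumℕ-zero {zero}  f≗0 = refl
sumℕ-zero {suc n} f≗0 = cong₂ _+ℕ_ (f≗0 fzero) (sumℕ-zero (λ i → f≗0 (fsuc i)))

count≡0⇒false : ∀ {n} (p : Fin n → Bool) → count p ≡ 0 → ∀ i → p i ≡ false
count≡0⇒false p count≡0 fzero with p fzero
... | false = refl
count≡0⇒false p count≡0 (fsuc i) with p fzero
... | false = count≡0⇒false (λ j → p (fsuc j)) count≡0 i

edge< : ∀ {n} → Graph n → Fin n → Fin n → Bool
edge< G x y = G x y ∧ (toℕ x <ᵇ toℕ y)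

module _ {n : ℕ} {G : Graph n} where

  sumF-𝟙-regular : ∀ {d} → IsRegular G d → ∀ x → sumF (λ y → 𝟙 (G x y)) ≡ ℕtoℚ d
  sumF-𝟙-regular reg x = trans (sym (ℕtoℚ-count (G x))) (cong ℕtoℚ (reg x))

  regular-degree≢0 : ∀ {d k} → IsRegular G d → EdgeConnectivity G k → 1 ≤ k → d ≢ 0
  regular-degree≢0 reg (_ , S , _ , _ , cut≡k) 1≤k refl =
    contradiction (subst (1 ≤_) (trans (sym cut≡k) cut≡0) 1≤k) λ ()
    where
    cut≡0 : cut G S ≡ 0
    cut≡0 = sumℕ-zero (λ x → sumℕ-zero (λ y →
      cong (λ b → if b ∧ inS S x ∧ not (inS S y) then 1 else 0) (count≡0⇒false (G x) (reg x) y)))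

  module _ (simple : IsSimpleGraph G) where

    𝟙-edge<-sym : ∀ x y → 𝟙 (edge< G x y) + 𝟙 (edge< G y x) ≡ 𝟙 (G x y)
    𝟙-edge<-sym x y with ℕP.<-cmp (toℕ x) (toℕ y)
    ... | tri< x<y _ y≮x rewrite <⇒<ᵇ≡true x<y | ≮⇒<ᵇ≡false y≮x
                               | ∧-identityʳ (G x y) | ∧-zeroʳ (G y x) = ℚP.+-identityʳ _
    ... | tri> x≮y _ y<x rewrite ≮⇒<ᵇ≡false x≮y | <⇒<ᵇ≡true y<x
                               | ∧-zeroʳ (G x y) | ∧-identityʳ (G y x) | proj₁ simple y x = ℚP.+-identityˡ _
    ... | tri≈ _ x≡y _ with FinP.toℕ-injective x≡y
    ... | refl rewrite proj₂ simple x = refl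

    sumPairs-edge<-symmetrise : (F : Fin n → Fin n → ℚ) →
      sumPairs (λ x y → 𝟙 (edge< G x y) * (F x y + F y x)) ≡ sumPairs (λ x y → 𝟙 (G x y) * F x y)
    sumPairs-edge<-symmetrise F = begin
      sumPairs (λ x y → e x y * (F x y + F y x))
        ≡⟨ sumPairs-cong (λ x y → ℚP.*-distribˡ-+ (e x y) (F x y) (F y x)) ⟩
      sumPairs (λ x y → e x y * F x y + e x y * F y x)
        ≡⟨ sumPairs-+ (λ x y → e x y * F x y) (λ x y → e x y * F y x) ⟩
      sumPairs (λ x y → e x y * F x y) + sumPairs (λ x y → e x y * F y x)
        ≡⟨ cong (sumPairs (λ x y → e x y * F x y) +_) (sumF-comm (λ x y → e x y * F y x)) ⟩
      sumPairs (λ x y → e x y * F x y) + sumPairs (λ x y → e y x * F x y)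
        ≡⟨ sym (sumPairs-+ (λ x y → e x y * F x y) (λ x y → e y x * F x y)) ⟩
      sumPairs (λ x y → e x y * F x y + e y x * F x y)
        ≡⟨ sumPairs-cong (λ x y → trans (sym (ℚP.*-distribʳ-+ (F x y) (e x y) (e y x)))
                                        (cong (_* F x y) (𝟙-edge<-sym x y))) ⟩
      sumPairs (λ x y → 𝟙 (G x y) * F x y) ∎
      where
      open ≡-Reasoning
      e : Fin n → Fin n → ℚ
      e x y = 𝟙 (edge< G x y)

    handshake : ∀ {d} → IsRegular G d → ℕtoℚ (edgeCount G) + ℕtoℚ (edgeCount G) ≡ ℕtoℚ n * ℕtoℚ d
    handshake {d} reg = begin
      ℕtoℚ (edgeCount G) + ℕtoℚ (edgeCount G)
        ≡⟨ cong₂ _+_ m≡ m≡ ⟩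
      sumPairs (λ x y → 𝟙 (edge< G x y)) + sumPairs (λ x y → 𝟙 (edge< G x y))
        ≡⟨ sym (sumPairs-+ (λ x y → 𝟙 (edge< G x y)) (λ x y → 𝟙 (edge< G x y))) ⟩
      sumPairs (λ x y → 𝟙 (edge< G x y) + 𝟙 (edge< G x y))
        ≡⟨ sumPairs-cong (λ x y → solve 1 (λ e → e :+ e := e :* (con 1ℚ :+ con 1ℚ)) refl (𝟙 (edge< G x y))) ⟩
      sumPairs (λ x y → 𝟙 (edge< G x y) * (1ℚ + 1ℚ))
        ≡⟨ sumPairs-edge<-symmetrise (λ _ _ → 1ℚ) ⟩
      sumPairs (λ x y → 𝟙 (G x y) * 1ℚ)
        ≡⟨ sumF-cong (λ x → trans (sumF-cong (λ y → ℚP.*-identityʳ (𝟙 (G x y)))) (sumF-𝟙-regular reg x)) ⟩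
      sumF {n} (λ _ → ℕtoℚ d)
        ≡⟨ sumF-const n (ℕtoℚ d) ⟩
      ℕtoℚ n * ℕtoℚ d ∎
      where
      open ≡-Reasoning
      m≡ = ℕtoℚ-countPairs (edge< G)

    sumPairs-edge<-δ : ∀ {d} → IsRegular G d → ∀ z →
      sumPairs (λ x y → 𝟙 (edge< G x y) * (δ x z + δ y z)) ≡ ℕtoℚ d
    sumPairs-edge<-δ reg z = begin
      sumPairs (λ x y → 𝟙 (edge< G x y) * (δ x z + δ y z))
        ≡⟨ sumPairs-edge<-symmetrise (λ x y → δ x z) ⟩
      sumPairs (λ x y → 𝟙 (G x y) * δ x z)
        ≡⟨ sumF-cong (λ x → trans (sumF-*ʳ (δ x z) (λ y → 𝟙 (G x y))) (ℚP.*-comm _ (δ x z))) ⟩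
      sumF (λ x → δ x z * sumF (λ y → 𝟙 (G x y)))
        ≡⟨ sumF-δ z (λ x → sumF (λ y → 𝟙 (G x y))) ⟩
      sumF (λ y → 𝟙 (G z y))
        ≡⟨ sumF-𝟙-regular reg z ⟩
      _ ∎
      where open ≡-Reasoning

-- Superpositions of unit flows

-- Strategy.g Sl Sr is superpose f (κ Sl Sr) by definition.
superpose : ∀ {n} → (Fin n → Fin n → Fin n → Fin n → ℚ) → (Fin n → Fin n → ℚ) → Fin n → Fin n → ℚ
superpose f w x y = sumPairs (λ u v → f u v x y * w u v)

module _ {n : ℕ} {G : Graph n} {f : Fin n → Fin n → Fin n → Fin n → ℚ}
         (flow : ∀ u v → IsUnitFlow G (f u v) u v) (w : Fin n → Fin n → ℚ) where

  superpose-antisym : ∀ x y → superpose f w y x ≡ - superpose f w x y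
  superpose-antisym x y = begin
    sumPairs (λ u v → f u v y x * w u v)
      ≡⟨ sumPairs-cong (λ u v → trans (cong (_* w u v) (proj₁ (flow u v) y x))
                                      (sym (ℚP.neg-distribˡ-* (f u v x y) (w u v)))) ⟩
    sumPairs (λ u v → - (f u v x y * w u v))
      ≡⟨ sumPairs-neg (λ u v → f u v x y * w u v) ⟩
    - sumPairs (λ u v → f u v x y * w u v) ∎
    where open ≡-Reasoning

  superpose-nonedge : ∀ {x y} → G x y ≡ false → superpose f w x y ≡ 0ℚ
  superpose-nonedge x≁y = sumF-zero (λ u → sumF-zero (λ v →
    trans (cong (_* w u v) (proj₁ (proj₂ (flow u v)) _ _ x≁y)) (ℚP.*-zeroˡ (w u v))))

  unitFlow-inflow : ∀ u v y → sumF (λ x → f u v x y) ≡ δ v y - δ u y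
  unitFlow-inflow u v y = begin
    sumF (λ x → f u v x y)    ≡⟨ sumF-cong (λ x → proj₁ (flow u v) x y) ⟩
    sumF (λ x → - f u v y x)  ≡⟨ sumF-neg (f u v y) ⟩
    - sumF (f u v y)          ≡⟨ cong -_ (proj₂ (proj₂ (flow u v)) y) ⟩
    - (δ u y - δ v y)         ≡⟨ solve 2 (λ a b → :- (a :- b) := b :- a) refl (δ u y) (δ v y) ⟩
    δ v y - δ u y             ∎
    where open ≡-Reasoning

  superpose-inflow : ∀ y → sumF (λ x → superpose f w x y) ≡ sumF (λ u → w u y) - sumF (λ v → w y v)
  superpose-inflow y = begin
    sumF (λ x → sumF (λ u → sumF (λ v → f u v x y * w u v)))
      ≡⟨ trans (sumF-comm (λ x u → sumF (λ v → f u v x y * w u v)))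
               (sumF-cong (λ u → sumF-comm (λ x v → f u v x y * w u v))) ⟩
    sumF (λ u → sumF (λ v → sumF (λ x → f u v x y * w u v)))
      ≡⟨ sumF-cong (λ u → sumF-cong (λ v → trans (sumF-*ʳ (w u v) (λ x → f u v x y))
                                                (cong (_* w u v) (unitFlow-inflow u v y)))) ⟩
    sumF (λ u → sumF (λ v → (δ v y - δ u y) * w u v))
      ≡⟨ sumF-cong (λ u → trans (sumF-cong (λ v → *-distribʳ-- (δ v y) (δ u y) (w u v)))
                                (sumF-- (λ v → δ v y * w u v) (λ v → δ u y * w u v))) ⟩
    sumF (λ u → sumF (λ v → δ v y * w u v) - sumF (λ v → δ u y * w u v))
      ≡⟨ sumF-- (λ u → sumF (λ v → δ v y * w u v)) (λ u → sumF (λ v → δ u y * w u v)) ⟩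
    sumF (λ u → sumF (λ v → δ v y * w u v)) - sumF (λ u → sumF (λ v → δ u y * w u v))
      ≡⟨ cong₂ _-_ (sumF-cong (λ u → sumF-δ y (w u)))
                   (trans (sumF-cong (λ u → sumF-*ˡ (δ u y) (w u))) (sumF-δ y (λ u → sumF (w u)))) ⟩
    sumF (λ u → w u y) - sumF (λ v → w y v) ∎
    where
    open ≡-Reasoning
    *-distribʳ-- : ∀ a b c → (a - b) * c ≡ a * c - b * c
    *-distribʳ-- = solve 3 (λ a b c → (a :- b) :* c := a :* c :- b :* c) refl

handshake-coefficients : ∀ {m n d} → d ≢ 0 → ℕtoℚ m + ℕtoℚ m ≡ ℕtoℚ (suc n) * ℕtoℚ d →
  divℕ 1ℚ m * ½ * ℕtoℚ d ≡ divℕ 1ℚ (suc n) × divℕ 1ℚ m * ½ ≡ divℕ 1ℚ (2 *ℕ m)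
handshake-coefficients {zero} {d = zero}  d≢0 _ = contradiction refl d≢0
handshake-coefficients {zero} {n} {suc d} _ 0≡nd =
  contradiction (trans (ℕtoℚ-* (suc n) (suc d)) (sym 0≡nd)) (ℕtoℚ-suc≢0 (d +ℕ n *ℕ suc d))
handshake-coefficients {suc m} {n} {d} _ 2m≡nd = divℕ-unique 1ℚ n (begin
    X * ½ * D * N        ≡⟨ solve 3 (λ x d n → x :* con ½ :* d :* n := x :* con ½ :* (n :* d)) refl X D N ⟩
    X * ½ * (N * D)      ≡⟨ cong (X * ½ *_) (sym 2m≡nd) ⟩
    X * ½ * (M + M)      ≡⟨ solve 2 (λ x m → x :* con ½ :* (m :+ m) := x :* m) refl X M ⟩
    X * M                ≡⟨ divℕ-cancelʳ 1ℚ m ⟩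
    1ℚ                   ∎)
  , divℕ-½ 1ℚ m
  where
  open ≡-Reasoning
  X = divℕ 1ℚ (suc m)
  M = ℕtoℚ (suc m)
  N = ℕtoℚ (suc n)
  D = ℕtoℚ d

κ-inflow-cases : ∀ c {na nb i j} → na ≡ suc i → nb ≡ suc j → ∀ (p q : Bool) → (p ≡ true → q ≡ true → ⊥) →
  ℕtoℚ na * (𝟙 q * divℕ c (na *ℕ nb)) - 𝟙 p * (ℕtoℚ nb * divℕ c (na *ℕ nb))
    ≡ (if p then - divℕ c na else (if q then divℕ c nb else 0ℚ))
κ-inflow-cases c         refl refl true  true  p∧q = ⊥-elim (p∧q refl refl)
κ-inflow-cases c {i = i} {j} refl refl true  false _ = begin
  I * (0ℚ * X) - 1ℚ * (J * X)
    ≡⟨ solve 3 (λ i x j → i :* (con 0ℚ :* x) :- con 1ℚ :* (j :* x) := :- (j :* x)) refl I X J ⟩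
  - (J * X)
    ≡⟨ cong (λ n → - (J * divℕ c n)) (ℕP.*-comm (suc i) (suc j)) ⟩
  - (J * divℕ c (suc j *ℕ suc i))
    ≡⟨ cong -_ (ℕtoℚ*divℕ-cancelˡ c j i) ⟩
  - divℕ c (suc i) ∎
  where
  open ≡-Reasoning
  I = ℕtoℚ (suc i)
  J = ℕtoℚ (suc j)
  X = divℕ c (suc i *ℕ suc j)
κ-inflow-cases c {i = i} {j} refl refl false true  _ = begin
  I * (1ℚ * X) - 0ℚ * (J * X)
    ≡⟨ solve 3 (λ i x j → i :* (con 1ℚ :* x) :- con 0ℚ :* (j :* x) := i :* x) refl I X J ⟩
  I * X
    ≡⟨ ℕtoℚ*divℕ-cancelˡ c i j ⟩
  divℕ c (suc j) ∎
  where
  open ≡-Reasoning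
  I = ℕtoℚ (suc i)
  J = ℕtoℚ (suc j)
  X = divℕ c (suc i *ℕ suc j)
κ-inflow-cases c {i = i} {j} refl refl false false _ =
  solve 3 (λ i x j → i :* (con 0ℚ :* x) :- con 0ℚ :* (j :* x) := con 0ℚ) refl
        (ℕtoℚ (suc i)) (divℕ c (suc i *ℕ suc j)) (ℕtoℚ (suc j))

module _ {n : ℕ} (G : Graph n) (f : Fin n → Fin n → Fin n → Fin n → ℚ) (α : ℚ) (k : ℕ) (T : BTree n) where
  open Strategy G f α k T

  dest-sgn : ∀ w x y s → dest w x y s ≡ ½ * (δ x w + δ y w) + ½ * sgn s * (δ y w - δ x w)
  dest-sgn w x y s with ℚP.<-cmp 0ℚ s
  ... | tri< 0<s _ _ rewrite pos⇒sgn≡1 0<s | ≤⇒≤ᵇ≡true (ℚP.<⇒≤ 0<s) | >⇒≤ᵇ≡false 0<s =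
    solve 2 (λ a b → b := con ½ :* (a :+ b) :+ con ½ :* con 1ℚ :* (b :- a)) refl (δ x w) (δ y w)
  ... | tri≈ _ refl _ =
    solve 2 (λ a b → con ½ :* (a :+ b) := con ½ :* (a :+ b) :+ con ½ :* con 0ℚ :* (b :- a)) refl (δ x w) (δ y w)
  ... | tri> _ _ s<0 rewrite neg⇒sgn≡-1 s<0 | >⇒≤ᵇ≡false s<0 =
    solve 2 (λ a b → a := con ½ :* (a :+ b) :+ con ½ :* con (- 1ℚ) :* (b :- a)) refl (δ x w) (δ y w)

  bias : (Fin n → ℕ) → Fin n → Fin n → ℚ
  bias L x y = sumI T (λ a b → g a b x y * Q L a b)

  probEdge-bias : ∀ L w x y → probEdge L w x y ≡ ½ * (δ x w + δ y w) + ½ * (δ y w - δ x w) * bias L x y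
  probEdge-bias L w x y = begin
    (1ℚ - A) * dest w x y 0ℚ + sumI T (λ a b → ∣ g a b x y ∣ℚ * dest w x y (sgn (g a b x y) * (avg L a - avg L b)))
      ≡⟨ cong ((1ℚ - A) * h +_) (sumI-cong T node) ⟩
    (1ℚ - A) * h + sumI T (λ a b → ∣ g a b x y ∣ℚ * h + ½ * e * (g a b x y * Q L a b))
      ≡⟨ cong ((1ℚ - A) * h +_) (trans (sumI-+ T (λ a b → ∣ g a b x y ∣ℚ * h) (λ a b → ½ * e * (g a b x y * Q L a b)))
                                       (cong₂ _+_ (sumI-*ʳ T h (λ a b → ∣ g a b x y ∣ℚ))
                                                  (sumI-*ˡ T (½ * e) (λ a b → g a b x y * Q L a b)))) ⟩
    (1ℚ - A) * h + (A * h + ½ * e * bias L x y)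
      ≡⟨ solve 4 (λ a h c p → (con 1ℚ :- a) :* h :+ (a :* h :+ c :* p) := h :+ c :* p) refl A h (½ * e) (bias L x y) ⟩
    h + ½ * e * bias L x y ∎
    where
    open ≡-Reasoning
    A = sumI T (λ a b → ∣ g a b x y ∣ℚ)
    h = ½ * (δ x w + δ y w)
    e = δ y w - δ x w
    node : ∀ a b → ∣ g a b x y ∣ℚ * dest w x y (sgn (g a b x y) * (avg L a - avg L b))
                 ≡ ∣ g a b x y ∣ℚ * h + ½ * e * (g a b x y * Q L a b)
    node a b = begin
      ∣ γ ∣ℚ * dest w x y (sgn γ * D)
        ≡⟨ cong (∣ γ ∣ℚ *_) (dest-sgn w x y (sgn γ * D)) ⟩
      ∣ γ ∣ℚ * (h + ½ * sgn (sgn γ * D) * e)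
        ≡⟨ solve 4 (λ a h s e → a :* (h :+ con ½ :* s :* e) := a :* h :+ con ½ :* e :* (a :* s))
                   refl ∣ γ ∣ℚ h (sgn (sgn γ * D)) e ⟩
      ∣ γ ∣ℚ * h + ½ * e * (∣ γ ∣ℚ * sgn (sgn γ * D))
        ≡⟨ cong (λ z → ∣ γ ∣ℚ * h + ½ * e * z) (∣p∣*sgn[sgn[p]*q]≡p*sgn[q] γ D) ⟩
      ∣ γ ∣ℚ * h + ½ * e * (γ * sgn D) ∎
      where
      γ = g a b x y
      D = avg L a - avg L b

  module _ (flow : ∀ u v → IsUnitFlow G (f u v) u v) where

    bias-antisym : ∀ L x y → bias L y x ≡ - bias L x y
    bias-antisym L x y = begin
      sumI T (λ a b → g a b y x * Q L a b)
        ≡⟨ sumI-cong T (λ a b → trans (cong (_* Q L a b) (superpose-antisym flow (κ a b) x y))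
                                      (sym (ℚP.neg-distribˡ-* (g a b x y) (Q L a b)))) ⟩
      sumI T (λ a b → - (g a b x y * Q L a b))
        ≡⟨ sumI-neg T (λ a b → g a b x y * Q L a b) ⟩
      - bias L x y ∎
      where open ≡-Reasoning

    bias-nonedge : ∀ L {x y} → G x y ≡ false → bias L x y ≡ 0ℚ
    bias-nonedge L x≁y = sumI-zero T (λ a b →
      trans (cong (_* Q L a b) (superpose-nonedge flow (κ a b) x≁y)) (ℚP.*-zeroˡ (Q L a b)))

    κ-inflow : ∀ {a b} → Empty (a ∩ b) → Nonempty a → Nonempty b → ∀ y → sumF (λ x → g a b x y) ≡ dI a b y
    κ-inflow {a} {b} a∩b≡∅ (_ , wa∈a) (_ , wb∈b) y with ∣∣≡suc wa∈a | ∣∣≡suc wb∈b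
    ... | i , ∣a∣≡1+i | j , ∣b∣≡1+j = begin
      sumF (λ x → g a b x y)
        ≡⟨ superpose-inflow flow (κ a b) y ⟩
      sumF (λ u → κ a b u y) - sumF (λ v → κ a b y v)
        ≡⟨ cong₂ _-_ column row ⟩
      ℕtoℚ ∣ a ∣ * (χb y * c) - χa y * (ℕtoℚ ∣ b ∣ * c)
        ≡⟨ κ-inflow-cases (β * ℕtoℚ k) ∣a∣≡1+i ∣b∣≡1+j (inS a y) (inS b y) a∌y∨b∌y ⟩
      dI a b y ∎
      where
      open ≡-Reasoning
      c = divℕ (β * ℕtoℚ k) (∣ a ∣ *ℕ ∣ b ∣)
      χa χb : Fin n → ℚ
      χa u = 𝟙 (inS a u)
      χb v = 𝟙 (inS b v)
      a∌y∨b∌y : inS a y ≡ true → inS b y ≡ true → ⊥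
      a∌y∨b∌y y∈a y∈b = ∩-empty⁻ a∩b≡∅ (lookup⇒[]= y a y∈a) (lookup⇒[]= y b y∈b)
      κ≡ : ∀ u v → κ a b u v ≡ χa u * χb v * c
      κ≡ u v = trans (if-then-0≡𝟙* (inS a u ∧ inS b v) c) (cong (_* c) (𝟙-∧ (inS a u) (inS b v)))
      column : sumF (λ u → κ a b u y) ≡ ℕtoℚ ∣ a ∣ * (χb y * c)
      column = begin
        sumF (λ u → κ a b u y)          ≡⟨ sumF-cong (λ u → trans (κ≡ u y) (ℚP.*-assoc (χa u) (χb y) c)) ⟩
        sumF (λ u → χa u * (χb y * c))  ≡⟨ sumF-*ʳ (χb y * c) χa ⟩
        sumF χa * (χb y * c)            ≡⟨ cong (_* (χb y * c)) (sym (ℕtoℚ-∣∣ a)) ⟩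
        ℕtoℚ ∣ a ∣ * (χb y * c)         ∎
      row : sumF (λ v → κ a b y v) ≡ χa y * (ℕtoℚ ∣ b ∣ * c)
      row = begin
        sumF (λ v → κ a b y v)
          ≡⟨ sumF-cong (λ v → trans (κ≡ y v)
                                    (solve 3 (λ p q r → p :* q :* r := (p :* r) :* q) refl (χa y) (χb v) c)) ⟩
        sumF (λ v → χa y * c * χb v)
          ≡⟨ sumF-*ˡ (χa y * c) χb ⟩
        χa y * c * sumF χb
          ≡⟨ cong (χa y * c *_) (sym (ℕtoℚ-∣∣ b)) ⟩
        χa y * c * ℕtoℚ ∣ b ∣
          ≡⟨ solve 3 (λ p r q → p :* r :* q := p :* (q :* r)) refl (χa y) c (ℕtoℚ ∣ b ∣) ⟩
        χa y * (ℕtoℚ ∣ b ∣ * c) ∎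

    sumF-bias : DisjointChildren T → ∀ L y → sumF (λ x → bias L x y) ≡ sumI T (λ a b → dI a b y * Q L a b)
    sumF-bias disjoint L y =
      trans (sumF-sumI T (λ x a b → g a b x y * Q L a b))
            (sumI-cong-disjoint T disjoint (λ a b a∩b≡∅ a≢∅ b≢∅ →
              trans (sumF-*ʳ (Q L a b) (λ x → g a b x y)) (cong (_* Q L a b) (κ-inflow a∩b≡∅ a≢∅ b≢∅ y))))

    module _ (simple : IsSimpleGraph G) where

      sumPairs-edge<-bias : ∀ L y →
        sumPairs (λ x z → 𝟙 (edge< G x z) * ((δ z y - δ x y) * bias L x z)) ≡ sumF (λ x → bias L x y)
      sumPairs-edge<-bias L y = begin
        sumPairs (λ x z → 𝟙 (edge< G x z) * ((δ z y - δ x y) * bias L x z))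
          ≡⟨ sumPairs-cong (λ x z → cong (𝟙 (edge< G x z) *_) (antisym x z)) ⟩
        sumPairs (λ x z → 𝟙 (edge< G x z) * (δ z y * bias L x z + δ x y * bias L z x))
          ≡⟨ sumPairs-edge<-symmetrise simple (λ x z → δ z y * bias L x z) ⟩
        sumPairs (λ x z → 𝟙 (G x z) * (δ z y * bias L x z))
          ≡⟨ sumF-cong (λ x → trans (sumF-cong (λ z → solve 3 (λ e d b → e :* (d :* b) := d :* (e :* b)) refl
                                                               (𝟙 (G x z)) (δ z y) (bias L x z)))
                                    (sumF-δ y (λ z → 𝟙 (G x z) * bias L x z))) ⟩
        sumF (λ x → 𝟙 (G x y) * bias L x y)
          ≡⟨ sumF-cong (λ x → 𝟙*bias x y) ⟩
        sumF (λ x → bias L x y) ∎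
        where
        open ≡-Reasoning
        antisym : ∀ x z → (δ z y - δ x y) * bias L x z ≡ δ z y * bias L x z + δ x y * bias L z x
        antisym x z = trans (solve 3 (λ a b p → (a :- b) :* p := a :* p :+ b :* (:- p)) refl
                                     (δ z y) (δ x y) (bias L x z))
                            (cong (λ q → δ z y * bias L x z + δ x y * q) (sym (bias-antisym L x z)))
        𝟙*bias : ∀ x z → 𝟙 (G x z) * bias L x z ≡ bias L x z
        𝟙*bias x z with G x z in x~z
        ... | true  = ℚP.*-identityˡ (bias L x z)
        ... | false = trans (ℚP.*-zeroˡ (bias L x z)) (sym (bias-nonedge L x~z))

      stepProb-expansion : ∀ {d} → IsRegular G d → DisjointChildren T → ∀ L y →
        stepProb L y ≡ divℕ 1ℚ m * ½ * ℕtoℚ d + divℕ 1ℚ m * ½ * sumI T (λ a b → dI a b y * Q L a b)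
      stepProb-expansion {d} reg disjoint L y = begin
        stepProb L y
          ≡⟨ sumPairs-cong (λ x z → trans (if-then-0≡𝟙* (edge< G x z) (M * probEdge L y x z))
                                           (cong (λ p → e x z * (M * p)) (probEdge-bias L y x z))) ⟩
        sumPairs (λ x z → e x z * (M * (½ * (δ x y + δ z y) + ½ * (δ z y - δ x y) * bias L x z)))
          ≡⟨ sumPairs-cong (λ x z → regroup (e x z) (δ x y + δ z y) (δ z y - δ x y) (bias L x z)) ⟩
        sumPairs (λ x z → M½ * A x z + M½ * B x z)
          ≡⟨ trans (sumPairs-+ (λ x z → M½ * A x z) (λ x z → M½ * B x z))
                   (cong₂ _+_ (sumPairs-*ˡ M½ A) (sumPairs-*ˡ M½ B)) ⟩
        M½ * sumPairs A + M½ * sumPairs B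
          ≡⟨ cong₂ (λ p q → M½ * p + M½ * q) (sumPairs-edge<-δ simple reg y)
                   (trans (sumPairs-edge<-bias L y) (sumF-bias disjoint L y)) ⟩
        M½ * ℕtoℚ d + M½ * sumI T (λ a b → dI a b y * Q L a b) ∎
        where
        open ≡-Reasoning
        M = divℕ 1ℚ m
        M½ = M * ½
        e A B : Fin n → Fin n → ℚ
        e x z = 𝟙 (edge< G x z)
        A x z = e x z * (δ x y + δ z y)
        B x z = e x z * ((δ z y - δ x y) * bias L x z)
        regroup : ∀ i h s p → i * (M * (½ * h + ½ * s * p)) ≡ M½ * (i * h) + M½ * (i * (s * p))
        regroup i h s p = solve 5 (λ i m h s p → i :* (m :* (con ½ :* h :+ con ½ :* s :* p))
                                                := (m :* con ½) :* (i :* h) :+ (m :* con ½) :* (i :* (s :* p)))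
                                  refl i M h s p

lemma4 : {n : ℕ} (G : Graph n) (d k : ℕ) (α : ℚ) (R : HTree n)
           (f : Fin n → Fin n → Fin n → Fin n → ℚ) (T : BTree n) →
           IsSimpleGraph G → IsRegular G d → EdgeConnectivity G k → 1 ≤ k →
           IsRacke G α R f → Binarize R T →
           (L : Fin n → ℕ) (y : Fin n) →
           Strategy.stepProb G f α k T L y
             ≡ divℕ 1ℚ n
               + divℕ 1ℚ (2 *ℕ Strategy.m G f α k T)
                 * sumI T (λ Sl Sr → Strategy.dI G f α k T Sl Sr y * Strategy.Q G f α k T L Sl Sr)
lemma4 {suc n} G d k α R f T simple regular connectivity 1≤k (_ , hd , _ , _ , flow , _) binarize L y = begin
  stepProb L y
    ≡⟨ stepProb-expansion G f α k T flow simple regular (binarize-disjoint hd binarize) L y ⟩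
  divℕ 1ℚ m * ½ * ℕtoℚ d + divℕ 1ℚ m * ½ * S
    ≡⟨ cong₂ (λ p q → p + q * S) (proj₁ coefficients) (proj₂ coefficients) ⟩
  divℕ 1ℚ (suc n) + divℕ 1ℚ (2 *ℕ m) * S ∎
  where
  open ≡-Reasoning
  open Strategy G f α k T
  S = sumI T (λ a b → dI a b y * Q L a b)
  coefficients = handshake-coefficients {m} {n} {d} (regular-degree≢0 {G = G} regular connectivity 1≤k)
                                                    (handshake simple regular)
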